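{- Let $k\ge 1$ and let $q=q_1q_2\ldots q_k$ be a permutation of the ordinary set $\{1,\ldots,k\}$. For positive integers $n,m$, let $S_{n,m}(q)$ denote the number of permutations of the regular multiset $[n]_m$ that avoid $q$. Then there exists a constant $e_q$, depending only on the length $k$ of $q$, such that for all positive integers $n$ and $m$, \[ S_{n,m}(q)\le e_q^{\,n\cdot m}. \]
   Context: The regular multiset $[n]_m=\{1^m,2^m,\ldots,n^m\}$ is the multiset in which each of the elements $1,\ldots,n$ occurs exactly $m$ times. A permutation of $[n]_m$ is a word $p=p_1p_2\ldots p_{nm}$ over $\{1,\ldots,n\}$ in which each letter $i\in\{1,\ldots,n\}$ occurs exactly $m$ times. Such a word $p$ contains the pattern $q=q_1\ldots q_k$ if there exist indices $i_1<i_2<\cdots<i_k$ such that the subsequence $p_{i_1}p_{i_2}\ldots p_{i_k}$ is order-isomorphic to $q$, i.e. for all $a,b\in\{1,\ldots,k\}$ we have $p_{i_a}<p_{i_b}\iff q_a<q_b$ and $p_{i_a}=p_{i_b}\iff q_a=q_b$ (so, since $q$ has distinct entries, the chosen entries of $p$ are pairwise distinct). Otherwise $p$ avoids $q$. -}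

module Defs where

open import Data.Nat using (ℕ; _*_)
open import Data.Fin using (Fin; _<_; _≟_)
open import Data.Vec using (Vec; lookup; count)
open import Data.Product using (Σ; _×_)
open import Data.List using (List; length)
open import Relation.Nullary using (¬_)
open import Relation.Binary.PropositionalEquality using (_≡_)
open import Function.Bundles using (_⇔_)
open import Function.Definitions using (Injective)

-- A pattern q = q_1 ... q_k that is a permutation of {1,...,k}
-- (letters encoded as Fin k, i.e. 0..k-1).
IsPermutation : (k : ℕ) → (Fin k → Fin k) → Set
IsPermutation k q = Injective _≡_ _≡_ q

IsMultisetPerm : (n m : ℕ) → Vec (Fin n) (n * m) → Set
IsMultisetPerm n m p = ∀ (i : Fin n) → count (_≟ i) p ≡ m

Contains : {k L n : ℕ} → Vec (Fin n) L → (Fin k → Fin k) → Set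
Contains {k} {L} {n} p q =
  Σ (Fin k → Fin L) λ f →
    (∀ a b → a < b → f a < f b) ×
    (∀ a b → (lookup p (f a) < lookup p (f b)) ⇔ (q a < q b)) ×
    (∀ a b → (lookup p (f a) ≡ lookup p (f b)) ⇔ (q a ≡ q b))

Avoids : {k L n : ℕ} → Vec (Fin n) L → (Fin k → Fin k) → Set
Avoids p q = ¬ Contains p q

-- A word over [n] of length L is encoded as the 0-1 matrix with a 1 in row p_y of column y;
-- an occurrence of the permutation matrix of q in it is an occurrence of q in the word, and
-- distinct words give distinct matrices. So it suffices to count N × N 0-1 matrices avoiding a
-- fixed k × k permutation matrix, and to show there are at most 2^(O(N)) of them.
--
-- Marcus–Tardos: cut an avoiding matrix of size B s (s = k² + 2) into s × s blocks. Its
-- contraction (one entry per block, set iff the block is nonzero) again avoids the pattern. In a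
-- block column fewer than k blocks can have nonzero columns at any fixed k positions, so there
-- are at most (k - 1) C(s, k) blocks with k nonzero columns; symmetrically for rows; every other
-- nonzero block has at most (k - 1)² ones. This gives f(B s) ≤ (k - 1)² f(B) + O(B), hence at
-- most c N ones.
--
-- Klazar: an avoiding matrix of size s B is determined by its contraction together with the set
-- of cells it occupies inside the at most c B nonzero blocks, so the number of such matrices
-- grows by a factor of at most 2^(s² c B) from size B to size s B.
module Submission where

open import Data.Bool using (Bool; true; false; _∨_; if_then_else_; T)
open import Data.Bool.Properties using (∨-identityʳ; ∨-zeroʳ; T?)
open import Data.Empty using (⊥-elim)
open import Data.Fin as Fin using (Fin; zero; suc; toℕ)
import Data.Fin.Properties as Fin
open import Data.List using (List; []; _∷_; _++_; length; map; concatMap; upTo; applyUpTo)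
import Data.List as List
open import Data.List.Properties using (length-++; length-map; length-upTo)
open import Data.List.Membership.Propositional using (_∈_; lose)
open import Data.List.Membership.Propositional.Properties
  using (∈-upTo⁺; ∈-upTo⁻; ∈-map⁺; ∈-++⁺ˡ; ∈-++⁺ʳ; ∈-concat⁺′; ∈-lookup)
open import Data.List.Relation.Unary.All as All using (All; []; _∷_)
import Data.List.Relation.Unary.All.Properties as All
open import Data.List.Relation.Unary.Any as Any using (Any; here; there)
import Data.List.Relation.Unary.Any.Properties as Any
open import Data.List.Relation.Unary.Unique.Propositional using (Unique)
open import Data.List.Relation.Unary.AllPairs using (_∷_)
open import Data.Nat
open import Data.Nat.DivMod using (_/_; _%_; m%n<n; m≡m%n+[m/n]*n; m<n*o⇒m/o<n)
open import Data.Nat.Properties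
open import Algebra.Properties.CommutativeSemigroup +-commutativeSemigroup using (interchange)
open import Data.Nat.Tactic.RingSolver using (solve-∀)
open import Data.Product using (Σ; ∃₂; ∃-syntax; _×_; _,_; proj₁; proj₂)
open import Data.Product.Properties using (≡-dec)
open import Data.Unit using (tt)
open import Data.Vec using (Vec; []; _∷_; lookup)
open import Data.Vec.Functional as Vector using (Vector)
open import Function using (_∘_; id)
open import Function.Bundles using (mk⇔)
open import Relation.Binary using (DecidableEquality; tri<; tri≈; tri>)
open import Relation.Binary.PropositionalEquality
open import Relation.Nullary using (¬_; yes; no)
open import Relation.Nullary.Decidable using (⌊_⌋; toWitness; fromWitness)

open import Defs

private variable
  A A′ : Set

-- Finite sums

⟦_⟧ : Bool → ℕ
⟦ true ⟧  = 1
⟦ false ⟧ = 0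

⟦⟧≤1 : ∀ b → ⟦ b ⟧ ≤ 1
⟦⟧≤1 true  = ≤-refl
⟦⟧≤1 false = z≤n

T⇒⟦⟧≡1 : ∀ {b} → T b → ⟦ b ⟧ ≡ 1
T⇒⟦⟧≡1 {true} _ = refl

⟦⟧>0⇒T : ∀ {b} → 0 < ⟦ b ⟧ → T b
⟦⟧>0⇒T {true} _ = tt

≤ᵇ≡false⇒> : ∀ {m n} → (m ≤ᵇ n) ≡ false → n < m
≤ᵇ≡false⇒> m≰ᵇn = ≰⇒> (λ m≤n → subst T m≰ᵇn (≤⇒≤ᵇ m≤n))

≤⇒≤*⟦>0⟧ : ∀ {x K} → x ≤ K → x ≤ K * ⟦ 0 <ᵇ x ⟧
≤⇒≤*⟦>0⟧ {zero}      _   = z≤n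
≤⇒≤*⟦>0⟧ {suc x} {K} x≤K = subst (suc x ≤_) (sym (*-identityʳ K)) x≤K

∈-if : ∀ {b} {xs ys : List A} {x} → T b → x ∈ xs → x ∈ (if b then xs else ys)
∈-if {b = true} _ x∈xs = x∈xs

∈-concatMap⁺ : ∀ {f : A → List A′} {xs x y} → x ∈ xs → y ∈ f x → y ∈ concatMap f xs
∈-concatMap⁺ {f = f} x∈xs y∈fx = ∈-concat⁺′ y∈fx (∈-map⁺ f x∈xs)

∑ : List A → (A → ℕ) → ℕ
∑ []       f = 0
∑ (x ∷ xs) f = f x + ∑ xs f

syntax ∑ xs (λ x → e) = ∑[ x ← xs ] e

∑-cong : ∀ (xs : List A) {f g : A → ℕ} → (∀ {x} → x ∈ xs → f x ≡ g x) → ∑ xs f ≡ ∑ xs g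
∑-cong []       f≡g = refl
∑-cong (x ∷ xs) f≡g = cong₂ _+_ (f≡g (here refl)) (∑-cong xs (f≡g ∘ there))

∑-mono : ∀ (xs : List A) {f g : A → ℕ} → (∀ {x} → x ∈ xs → f x ≤ g x) → ∑ xs f ≤ ∑ xs g
∑-mono []       f≤g = z≤n
∑-mono (x ∷ xs) f≤g = +-mono-≤ (f≤g (here refl)) (∑-mono xs (f≤g ∘ there))

∑-+ : ∀ (xs : List A) (f g : A → ℕ) → ∑[ x ← xs ] (f x + g x) ≡ ∑ xs f + ∑ xs g
∑-+ []       f g = refl
∑-+ (x ∷ xs) f g =
  trans (cong (f x + g x +_) (∑-+ xs f g)) (interchange (f x) (g x) (∑ xs f) (∑ xs g))

∑-*ˡ : ∀ (xs : List A) (a : ℕ) (f : A → ℕ) → ∑[ x ← xs ] (a * f x) ≡ a * ∑ xs f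
∑-*ˡ []       a f = sym (*-zeroʳ a)
∑-*ˡ (x ∷ xs) a f =
  trans (cong (a * f x +_) (∑-*ˡ xs a f)) (sym (*-distribˡ-+ a (f x) (∑ xs f)))

∑-*ʳ : ∀ (xs : List A) (a : ℕ) (f : A → ℕ) → ∑[ x ← xs ] (f x * a) ≡ ∑ xs f * a
∑-*ʳ xs a f =
  trans (∑-cong xs (λ {x} _ → *-comm (f x) a)) (trans (∑-*ˡ xs a f) (*-comm a (∑ xs f)))

∑-const : ∀ (xs : List A) (a : ℕ) → ∑[ _ ← xs ] a ≡ length xs * a
∑-const []       a = refl
∑-const (x ∷ xs) a = cong (a +_) (∑-const xs a)

∑-≤-const : ∀ (xs : List A) {f : A → ℕ} {a} → (∀ {x} → x ∈ xs → f x ≤ a) → ∑ xs f ≤ length xs * a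
∑-≤-const xs {a = a} f≤a = ≤-trans (∑-mono xs f≤a) (≤-reflexive (∑-const xs a))

∑-comm : ∀ (xs : List A) (ys : List A′) (f : A → A′ → ℕ) →
         ∑[ x ← xs ] ∑[ y ← ys ] f x y ≡ ∑[ y ← ys ] ∑[ x ← xs ] f x y
∑-comm []       ys f = sym (trans (∑-const ys 0) (*-zeroʳ (length ys)))
∑-comm (x ∷ xs) ys f =
  trans (cong (∑ ys (f x) +_) (∑-comm xs ys f)) (sym (∑-+ ys (f x) (λ y → ∑[ x ← xs ] f x y)))

∈⇒≤∑ : ∀ {xs : List A} {x} (f : A → ℕ) → x ∈ xs → f x ≤ ∑ xs f
∈⇒≤∑ {xs = y ∷ xs} f (here refl)  = m≤m+n (f y) (∑ xs f)
∈⇒≤∑ {xs = y ∷ xs} f (there x∈xs) = ≤-trans (∈⇒≤∑ f x∈xs) (m≤n+m (∑ xs f) (f y))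

∑>0⇒∃ : ∀ (xs : List A) (f : A → ℕ) → 0 < ∑ xs f → ∃[ x ] x ∈ xs × 0 < f x
∑>0⇒∃ (x ∷ xs) f ∑>0 with 0 <? f x
... | yes fx>0 = x , here refl , fx>0
... | no  fx≯0 =
  let y , y∈xs , fy>0 = ∑>0⇒∃ xs f (subst (λ v → 0 < v + ∑ xs f) (n≤0⇒n≡0 (≮⇒≥ fx≯0)) ∑>0)
  in  y , there y∈xs , fy>0

∑>0⇒∃-T : ∀ (xs : List A) (P : A → Bool) → 0 < ∑[ x ← xs ] ⟦ P x ⟧ → ∃[ x ] x ∈ xs × T (P x)
∑>0⇒∃-T xs P ∑>0 = let x , x∈xs , Px>0 = ∑>0⇒∃ xs (⟦_⟧ ∘ P) ∑>0 in x , x∈xs , ⟦⟧>0⇒T Px>0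

length-concatMap : ∀ (f : A → List A′) xs → length (concatMap f xs) ≡ ∑[ x ← xs ] length (f x)
length-concatMap f []       = refl
length-concatMap f (x ∷ xs) = trans (length-++ (f x)) (cong (length (f x) +_) (length-concatMap f xs))

∑-applyUpTo : ∀ (g : ℕ → A) n (f : A → ℕ) → ∑ (applyUpTo g n) f ≡ ∑[ i ← upTo n ] f (g i)
∑-applyUpTo g zero    f = refl
∑-applyUpTo g (suc n) f =
  cong (f (g 0) +_) (trans (∑-applyUpTo (g ∘ suc) n f) (sym (∑-applyUpTo suc n (f ∘ g))))

∑-upTo-suc : ∀ n (f : ℕ → ℕ) → ∑ (upTo (suc n)) f ≡ f 0 + ∑[ i ← upTo n ] f (suc i)
∑-upTo-suc n f = cong (f 0 +_) (∑-applyUpTo suc n f)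

∑-upTo-+ : ∀ m n (f : ℕ → ℕ) → ∑ (upTo (m + n)) f ≡ ∑ (upTo m) f + ∑[ i ← upTo n ] f (m + i)
∑-upTo-+ zero    n f = refl
∑-upTo-+ (suc m) n f = begin
  ∑ (upTo (suc (m + n))) f                                        ≡⟨ ∑-upTo-suc (m + n) f ⟩
  f 0 + ∑ (upTo (m + n)) (f ∘ suc)                                ≡⟨ cong (f 0 +_) (∑-upTo-+ m n (f ∘ suc)) ⟩
  f 0 + (∑ (upTo m) (f ∘ suc) + ∑[ i ← upTo n ] f (suc (m + i)))  ≡⟨ +-assoc (f 0) _ rest ⟨
  f 0 + ∑ (upTo m) (f ∘ suc) + rest                               ≡⟨ cong (_+ rest) (∑-upTo-suc m f) ⟨
  ∑ (upTo (suc m)) f + rest                                       ∎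
  where
  open ≡-Reasoning
  rest : ℕ
  rest = ∑[ i ← upTo n ] f (suc m + i)

∑-upTo-* : ∀ s B (f : ℕ → ℕ) → ∑ (upTo (B * s)) f ≡ ∑[ I ← upTo B ] ∑[ i ← upTo s ] f (I * s + i)
∑-upTo-* s zero    f = refl
∑-upTo-* s (suc B) f = begin
  ∑ (upTo (s + B * s)) f
    ≡⟨ ∑-upTo-+ s (B * s) f ⟩
  ∑ (upTo s) f + ∑[ x ← upTo (B * s) ] f (s + x)
    ≡⟨ cong (∑ (upTo s) f +_) (∑-upTo-* s B (λ x → f (s + x))) ⟩
  ∑ (upTo s) f + ∑[ I ← upTo B ] ∑[ i ← upTo s ] f (s + (I * s + i))
    ≡⟨ cong (∑ (upTo s) f +_) (∑-cong (upTo B) (λ {I} _ → ∑-cong (upTo s) (λ {i} _ →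
         cong f (+-assoc s (I * s) i)))) ⟨
  ∑ (upTo s) f + ∑[ I ← upTo B ] ∑[ i ← upTo s ] f (suc I * s + i)
    ≡⟨ ∑-upTo-suc B (λ I → ∑[ i ← upTo s ] f (I * s + i)) ⟨
  ∑[ I ← upTo (suc B) ] ∑[ i ← upTo s ] f (I * s + i)
    ∎
  where open ≡-Reasoning

∑² : ℕ → (ℕ → ℕ → ℕ) → ℕ
∑² N f = ∑[ x ← upTo N ] ∑[ y ← upTo N ] f x y

∑²-cong : ∀ N {f g : ℕ → ℕ → ℕ} → (∀ {x y} → x < N → y < N → f x y ≡ g x y) →
          ∑² N f ≡ ∑² N g
∑²-cong N f≡g =
  ∑-cong (upTo N) (λ x∈ → ∑-cong (upTo N) (λ y∈ → f≡g (∈-upTo⁻ x∈) (∈-upTo⁻ y∈)))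

∑²-mono : ∀ N {f g : ℕ → ℕ → ℕ} → (∀ {x y} → x < N → y < N → f x y ≤ g x y) →
          ∑² N f ≤ ∑² N g
∑²-mono N f≤g =
  ∑-mono (upTo N) (λ x∈ → ∑-mono (upTo N) (λ y∈ → f≤g (∈-upTo⁻ x∈) (∈-upTo⁻ y∈)))

∑²-+ : ∀ N (f g : ℕ → ℕ → ℕ) → ∑² N (λ x y → f x y + g x y) ≡ ∑² N f + ∑² N g
∑²-+ N f g =
  trans (∑-cong (upTo N) (λ {x} _ → ∑-+ (upTo N) (f x) (g x)))
        (∑-+ (upTo N) (λ x → ∑ (upTo N) (f x)) (λ x → ∑ (upTo N) (g x)))

∑²-*ˡ : ∀ N a (f : ℕ → ℕ → ℕ) → ∑² N (λ x y → a * f x y) ≡ a * ∑² N f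
∑²-*ˡ N a f = trans (∑-cong (upTo N) (λ {x} _ → ∑-*ˡ (upTo N) a (f x))) (∑-*ˡ (upTo N) a _)

∑²-comm : ∀ N (f : ℕ → ℕ → ℕ) → ∑² N f ≡ ∑² N (λ x y → f y x)
∑²-comm N f = ∑-comm (upTo N) (upTo N) f

-- Increasing tuples

Increasing : ∀ {k} → Vector ℕ k → Set
Increasing g = ∀ {a b} → a Fin.< b → g a < g b

increasingTuples : (k n : ℕ) → List (Vector ℕ k)
increasingTuples zero    n       = Vector.[] ∷ []
increasingTuples (suc k) zero    = []
increasingTuples (suc k) (suc n) =
  map (λ g → 0 Vector.∷ Vector.map suc g) (increasingTuples k n) ++
  map (Vector.map suc) (increasingTuples (suc k) n)

increasingTuples-increasing :
  ∀ k n → All (λ g → Increasing g × (∀ a → g a < n)) (increasingTuples k n)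
increasingTuples-increasing zero    n       = ((λ { {()} }) , λ ()) ∷ []
increasingTuples-increasing (suc k) zero    = []
increasingTuples-increasing (suc k) (suc n) =
  All.++⁺ (All.map⁺ (All.map prepend0 (increasingTuples-increasing k n)))
          (All.map⁺ (All.map shift (increasingTuples-increasing (suc k) n)))
  where
  prepend0 : ∀ {g : Vector ℕ k} → Increasing g × (∀ a → g a < n) →
             Increasing (0 Vector.∷ Vector.map suc g) ×
             (∀ a → (0 Vector.∷ Vector.map suc g) a < suc n)
  prepend0 {g} (g-inc , g<n) = inc , bound
    where
    inc : Increasing (0 Vector.∷ Vector.map suc g)
    inc {zero}  {suc b} _         = s≤s z≤n
    inc {suc a} {suc b} (s≤s a<b) = s≤s (g-inc a<b)
    bound : ∀ a → (0 Vector.∷ Vector.map suc g) a < suc n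
    bound zero    = s≤s z≤n
    bound (suc a) = s≤s (g<n a)
  shift : ∀ {g : Vector ℕ (suc k)} → Increasing g × (∀ a → g a < n) →
          Increasing (Vector.map suc g) × (∀ a → suc (g a) < suc n)
  shift (g-inc , g<n) = s≤s ∘ g-inc , s≤s ∘ g<n

∃-increasingTuple : ∀ k n (P : ℕ → Bool) → k ≤ ∑[ i ← upTo n ] ⟦ P i ⟧ →
                    ∃[ g ] g ∈ increasingTuples k n × (∀ a → T (P (g a)))
∃-increasingTuple zero    n       P _ = Vector.[] , here refl , λ ()
∃-increasingTuple (suc k) zero    P ()
∃-increasingTuple (suc k) (suc n) P k≤count
  with P 0 in P0 | subst (suc k ≤_) (∑-upTo-suc n (⟦_⟧ ∘ P)) k≤count
... | true  | s≤s k≤rest =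
  let g , g∈ , Pg = ∃-increasingTuple k n (P ∘ suc) k≤rest
  in  0 Vector.∷ Vector.map suc g
    , ∈-++⁺ˡ (∈-map⁺ (λ g → 0 Vector.∷ Vector.map suc g) g∈)
    , λ { zero → subst T (sym P0) tt ; (suc a) → Pg a }
... | false | k<rest =
  let g , g∈ , Pg = ∃-increasingTuple (suc k) n (P ∘ suc) k<rest
  in  Vector.map suc g , ∈-++⁺ʳ _ (∈-map⁺ (Vector.map suc) g∈) , Pg

-- 0-1 matrices

-- Matrices are infinite; the N × N matrices are their restrictions to [0, N)².
Matrix : Set
Matrix = ℕ → ℕ → Bool

transpose : Matrix → Matrix
transpose M x y = M y x

ones : ℕ → Matrix → ℕ
ones N M = ∑² N (λ x y → ⟦ M x y ⟧)

entry≤ones : ∀ {N} (M : Matrix) {x y} → x < N → y < N → ⟦ M x y ⟧ ≤ ones N M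
entry≤ones {N} M {x} x<N y<N =
  ≤-trans (∈⇒≤∑ (λ y → ⟦ M x y ⟧) (∈-upTo⁺ y<N))
          (∈⇒≤∑ (λ x → ∑[ y ← upTo N ] ⟦ M x y ⟧) (∈-upTo⁺ x<N))

hit⇒ones>0 : ∀ {N} (M : Matrix) {x y} → x < N → y < N → T (M x y) → 0 < ones N M
hit⇒ones>0 M x<N y<N hit = ≤-trans (≤-reflexive (sym (T⇒⟦⟧≡1 hit))) (entry≤ones M x<N y<N)

ones>0⇒hit : ∀ N (M : Matrix) → 0 < ones N M → ∃₂ λ x y → x < N × y < N × T (M x y)
ones>0⇒hit N M ones>0 =
  let x , x∈ , row>0 = ∑>0⇒∃ (upTo N) _ ones>0
      y , y∈ , hit   = ∑>0⇒∃-T (upTo N) (M x) row>0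
  in  x , y , ∈-upTo⁻ x∈ , ∈-upTo⁻ y∈ , hit

ones≤N*N : ∀ N M → ones N M ≤ N * N
ones≤N*N N M = begin
  ones N M                                 ≤⟨ ∑-≤-const (upTo N) (λ _ → ∑-≤-const (upTo N) (λ _ → ⟦⟧≤1 _)) ⟩
  length (upTo N) * (length (upTo N) * 1)  ≡⟨ cong (λ L → L * (L * 1)) (length-upTo N) ⟩
  N * (N * 1)                              ≡⟨ cong (N *_) (*-identityʳ N) ⟩
  N * N                                    ∎
  where open ≤-Reasoning

columnNonzero : ℕ → Matrix → ℕ → Bool
columnNonzero N M j = 0 <ᵇ ∑[ i ← upTo N ] ⟦ M i j ⟧

width : ℕ → Matrix → ℕ
width N M = ∑[ j ← upTo N ] ⟦ columnNonzero N M j ⟧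

height : ℕ → Matrix → ℕ
height N M = width N (transpose M)

hit⇒columnNonzero : ∀ N (M : Matrix) {i j} → i < N → T (M i j) → T (columnNonzero N M j)
hit⇒columnNonzero N M {j = j} i<N hit =
  <⇒<ᵇ (≤-trans (≤-reflexive (sym (T⇒⟦⟧≡1 hit))) (∈⇒≤∑ (λ i → ⟦ M i j ⟧) (∈-upTo⁺ i<N)))

ones≤height*width : ∀ N M → ones N M ≤ height N M * width N M
ones≤height*width N M = begin
  ones N M
    ≤⟨ ∑²-mono N entry≤ ⟩
  ∑² N (λ i j → ⟦ rowNonzero i ⟧ * ⟦ colNonzero j ⟧)
    ≡⟨ ∑-cong (upTo N) (λ {i} _ → ∑-*ˡ (upTo N) ⟦ rowNonzero i ⟧ (λ j → ⟦ colNonzero j ⟧)) ⟩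
  ∑[ i ← upTo N ] (⟦ rowNonzero i ⟧ * width N M)
    ≡⟨ ∑-*ʳ (upTo N) (width N M) (λ i → ⟦ rowNonzero i ⟧) ⟩
  height N M * width N M
    ∎
  where
  open ≤-Reasoning
  rowNonzero colNonzero : ℕ → Bool
  rowNonzero = columnNonzero N (transpose M)
  colNonzero = columnNonzero N M
  entry≤ : ∀ {i j} → i < N → j < N → ⟦ M i j ⟧ ≤ ⟦ rowNonzero i ⟧ * ⟦ colNonzero j ⟧
  entry≤ {i} {j} i<N j<N with M i j in Mij
  ... | false = z≤n
  ... | true  = ≤-reflexive (sym (cong₂ _*_ (T⇒⟦⟧≡1 (hit⇒columnNonzero N (transpose M) j<N hit))
                                           (T⇒⟦⟧≡1 (hit⇒columnNonzero N M i<N hit))))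
    where
    hit : T (M i j)
    hit = subst T (sym Mij) tt

-- A nonzero matrix is wide (k nonzero columns), tall (k nonzero rows), or else covered by
-- fewer than k rows and columns and so has at most (k - 1)² ones.
ones≤narrow+wide+tall : ∀ k N M →
  ones N M ≤ pred k * pred k * ⟦ 0 <ᵇ ones N M ⟧
             + N * N * ⟦ k ≤ᵇ width N M ⟧ + N * N * ⟦ k ≤ᵇ height N M ⟧
ones≤narrow+wide+tall k N M = bound
  where
  narrowTerm : ℕ
  narrowTerm = pred k * pred k * ⟦ 0 <ᵇ ones N M ⟧
  ones≤N*N*1 : ones N M ≤ N * N * 1
  ones≤N*N*1 = ≤-trans (ones≤N*N N M) (≤-reflexive (sym (*-identityʳ (N * N))))
  narrow : height N M < k → width N M < k → ones N M ≤ pred k * pred k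
  narrow h<k w<k = ≤-trans (ones≤height*width N M) (*-mono-≤ (<⇒≤pred h<k) (<⇒≤pred w<k))
  bound : ones N M ≤ narrowTerm + N * N * ⟦ k ≤ᵇ width N M ⟧ + N * N * ⟦ k ≤ᵇ height N M ⟧
  bound with k ≤ᵇ width N M in wide | k ≤ᵇ height N M in tall
  ... | true  | t     = ≤-trans ones≤N*N*1 (≤-trans (m≤n+m (N * N * 1) narrowTerm) (m≤m+n _ (N * N * ⟦ t ⟧)))
  ... | false | true  = ≤-trans ones≤N*N*1 (m≤n+m (N * N * 1) (narrowTerm + N * N * 0))
  ... | false | false =
    ≤-trans (≤⇒≤*⟦>0⟧ (narrow (≤ᵇ≡false⇒> {k} {height N M} tall) (≤ᵇ≡false⇒> {k} {width N M} wide)))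
            (≤-trans (m≤m+n narrowTerm (N * N * 0)) (m≤m+n _ (N * N * 0)))

-- The a-th point of the pattern has row rank α a and column rank β a.
record Occurrence {k} (α β : Fin k → Fin k) (N : ℕ) (M : Matrix) : Set where
  field
    row col  : Fin k → ℕ
    row<N    : ∀ a → row a < N
    col<N    : ∀ a → col a < N
    row-mono : ∀ {a b} → α a Fin.< α b → row a < row b
    col-mono : ∀ {a b} → β a Fin.< β b → col a < col b
    hit      : ∀ a → T (M (row a) (col a))

occurrence-transpose : ∀ {k} {α β : Fin k → Fin k} {N M} →
                       Occurrence β α N (transpose M) → Occurrence α β N M
occurrence-transpose o = record
  { row = col ; col = row ; row<N = col<N ; col<N = row<N
  ; row-mono = col-mono ; col-mono = row-mono ; hit = hit }
  where open Occurrence o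

Agree : ℕ → Matrix → Matrix → Set
Agree N M₀ M = ∀ {x y} → x < N → y < N → M₀ x y ≡ M x y

agree-ones : ∀ {N M₀ M} → Agree N M₀ M → ones N M₀ ≡ ones N M
agree-ones {N} agree = ∑²-cong N (λ x<N y<N → cong ⟦_⟧ (agree x<N y<N))

_⊆_ : Matrix → Matrix → Set
M₀ ⊆ M = ∀ {x y} → T (M₀ x y) → T (M x y)

⊆-false : ∀ {M₀ M x y} → M₀ ⊆ M → M x y ≡ false → M₀ x y ≡ false
⊆-false {M₀} {x = x} {y} M₀⊆M Mxy with M₀ x y in M₀xy
... | false = refl
... | true  = ⊥-elim (subst T Mxy (M₀⊆M (subst T (sym M₀xy) tt)))

_≟²_ : DecidableEquality (ℕ × ℕ)
_≟²_ = ≡-dec _≟_ _≟_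

insert : ℕ × ℕ → Matrix → Matrix
insert cell M x y = M x y ∨ ⌊ (x , y) ≟² cell ⌋

subMatrices : List (ℕ × ℕ) → List Matrix
subMatrices []             = (λ _ _ → false) ∷ []
subMatrices (cell ∷ cells) = subMatrices cells ++ map (insert cell) (subMatrices cells)

length-subMatrices : ∀ cells → length (subMatrices cells) ≡ 2 ^ length cells
length-subMatrices []             = refl
length-subMatrices (cell ∷ cells) = begin
  length (Ms ++ map (insert cell) Ms)       ≡⟨ length-++ Ms ⟩
  length Ms + length (map (insert cell) Ms)  ≡⟨ cong (length Ms +_) (length-map (insert cell) Ms) ⟩
  length Ms + length Ms                      ≡⟨ cong (λ l → l + l) (length-subMatrices cells) ⟩
  2 ^ length cells + 2 ^ length cells        ≡⟨ cong (2 ^ length cells +_) (+-identityʳ _) ⟨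
  2 ^ length (cell ∷ cells)                  ∎
  where
  open ≡-Reasoning
  Ms : List Matrix
  Ms = subMatrices cells

∃-subMatrix : ∀ cells M →
              ∃[ M₀ ] M₀ ∈ subMatrices cells × M₀ ⊆ M × (∀ {x y} → (x , y) ∈ cells → M₀ x y ≡ M x y)
∃-subMatrix []              M = (λ _ _ → false) , here refl , (λ ()) , λ ()
∃-subMatrix ((a , b) ∷ cells) M with ∃-subMatrix cells M | M a b in Mab
... | M₁ , M₁∈ , M₁⊆M , M₁≡M | false = M₁ , ∈-++⁺ˡ M₁∈ , M₁⊆M , M₁≡M′
  where
  M₁≡M′ : ∀ {x y} → (x , y) ∈ (a , b) ∷ cells → M₁ x y ≡ M x y
  M₁≡M′ (here refl) = trans (⊆-false {M₁} {M} M₁⊆M Mab) (sym Mab)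
  M₁≡M′ (there c∈)  = M₁≡M c∈
... | M₁ , M₁∈ , M₁⊆M , M₁≡M | true =
  insert (a , b) M₁ , ∈-++⁺ʳ _ (∈-map⁺ (insert (a , b)) M₁∈) , M₀⊆M , M₀≡M
  where
  M₀⊆M : insert (a , b) M₁ ⊆ M
  M₀⊆M {x} {y} hit with (x , y) ≟² (a , b)
  ... | yes refl = subst T (sym Mab) tt
  ... | no  _    = M₁⊆M (subst T (∨-identityʳ (M₁ x y)) hit)
  M₀≡M : ∀ {x y} → (x , y) ∈ (a , b) ∷ cells → insert (a , b) M₁ x y ≡ M x y
  M₀≡M {x} {y} c∈ with (x , y) ≟² (a , b) | c∈
  ... | yes refl | _         = trans (∨-zeroʳ (M₁ a b)) (sym Mab)
  ... | no  c≢ab | here refl = ⊥-elim (c≢ab refl)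
  ... | no  _    | there c∈′ = trans (∨-identityʳ (M₁ x y)) (M₁≡M c∈′)

-- Words as matrices

wordMatrix : ∀ {n L} → Vec (Fin n) L → Matrix
wordMatrix []      x y       = false
wordMatrix (a ∷ p) x zero    = toℕ a ≡ᵇ x
wordMatrix (a ∷ p) x (suc y) = wordMatrix p x y

wordMatrix-hit : ∀ {n L} (p : Vec (Fin n) L) {x y} → T (wordMatrix p x y) →
                 ∃[ i ] toℕ i ≡ y × toℕ (lookup p i) ≡ x
wordMatrix-hit (a ∷ p) {y = zero}  hit = zero , refl , ≡ᵇ⇒≡ _ _ hit
wordMatrix-hit (a ∷ p) {y = suc y} hit =
  let i , i≡y , pi≡x = wordMatrix-hit p hit in suc i , cong suc i≡y , pi≡x

wordMatrix-injective : ∀ {n L} (p p′ : Vec (Fin n) L) →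
                       (∀ {x y} → x < n → y < L → wordMatrix p x y ≡ wordMatrix p′ x y) → p ≡ p′
wordMatrix-injective []      []        _     = refl
wordMatrix-injective (a ∷ p) (a′ ∷ p′) agree =
  cong₂ _∷_ (Fin.toℕ-injective (sym (≡ᵇ⇒≡ _ _ a′≡a)))
            (wordMatrix-injective p p′ (λ x<n y<L → agree x<n (s≤s y<L)))
  where
  a′≡a : T (toℕ a′ ≡ᵇ toℕ a)
  a′≡a = subst T (agree (Fin.toℕ<n a) (s≤s z≤n)) (≡⇒≡ᵇ (toℕ a) (toℕ a) refl)

-- Rows are values and columns are positions, so the pattern q is placed by α = q and β = id.
occurrence⇒contains : ∀ {k n L N} {q : Fin k → Fin k} → IsPermutation k q → (p : Vec (Fin n) L) →
                      Occurrence q id N (wordMatrix p) → Contains p q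
occurrence⇒contains {k} {L = L} {q = q} q-inj p o =
  f , f-mono , (λ _ _ → mk⇔ <-reflect <-preserve) , (λ _ _ → mk⇔ ≡-reflect ≡-preserve)
  where
  module O = Occurrence o
  f : Fin k → Fin L
  f a = proj₁ (wordMatrix-hit p (O.hit a))
  f≡col : ∀ a → toℕ (f a) ≡ O.col a
  f≡col a = proj₁ (proj₂ (wordMatrix-hit p (O.hit a)))
  p∘f≡row : ∀ a → toℕ (lookup p (f a)) ≡ O.row a
  p∘f≡row a = proj₂ (proj₂ (wordMatrix-hit p (O.hit a)))
  f-mono : ∀ a b → a Fin.< b → f a Fin.< f b
  f-mono a b a<b = subst₂ _<_ (sym (f≡col a)) (sym (f≡col b)) (O.col-mono a<b)
  <-preserve : ∀ {a b} → q a Fin.< q b → lookup p (f a) Fin.< lookup p (f b)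
  <-preserve {a} {b} lt = subst₂ _<_ (sym (p∘f≡row a)) (sym (p∘f≡row b)) (O.row-mono lt)
  <-reflect : ∀ {a b} → lookup p (f a) Fin.< lookup p (f b) → q a Fin.< q b
  <-reflect {a} {b} lt with Fin.<-cmp (q a) (q b)
  ... | tri< qa<qb _ _ = qa<qb
  ... | tri≈ _ qa≡qb _ rewrite q-inj qa≡qb = ⊥-elim (<-irrefl refl lt)
  ... | tri> _ _ qb<qa = ⊥-elim (<-asym lt (<-preserve qb<qa))
  ≡-preserve : ∀ {a b} → q a ≡ q b → lookup p (f a) ≡ lookup p (f b)
  ≡-preserve qa≡qb = cong (lookup p ∘ f) (q-inj qa≡qb)
  ≡-reflect : ∀ {a b} → lookup p (f a) ≡ lookup p (f b) → q a ≡ q b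
  ≡-reflect {a} {b} eq with Fin.<-cmp (q a) (q b)
  ... | tri≈ _ qa≡qb _ = qa≡qb
  ... | tri< qa<qb _ _ = ⊥-elim (<-irrefl (cong toℕ eq) (<-preserve qa<qb))
  ... | tri> _ _ qb<qa = ⊥-elim (<-irrefl (cong toℕ (sym eq)) (<-preserve qb<qa))

unique⇒lookup-≢ : ∀ {xs : List A} → Unique xs →
                  ∀ {i j} → i Fin.< j → List.lookup xs i ≢ List.lookup xs j
unique⇒lookup-≢ (x∉xs ∷ _)   {zero}  {suc j} _         = All.lookup x∉xs (∈-lookup j)
unique⇒lookup-≢ (_ ∷ unique) {suc i} {suc j} (s≤s i<j) = unique⇒lookup-≢ unique i<j

length-≤-by-code : ∀ (R : A → A′ → Set) {xs : List A} {ys : List A′} → Unique xs →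
                   (∀ {x} → x ∈ xs → Any (R x) ys) → (∀ {x x′ y} → R x y → R x′ y → x ≡ x′) →
                   length xs ≤ length ys
length-≤-by-code R {xs} {ys} unique code R-injective with length xs ≤? length ys
... | yes xs≤ys = xs≤ys
... | no  xs≰ys =
  let i , j , i<j , same = Fin.pigeonhole (≰⇒> xs≰ys) (Any.index ∘ code′)
  in  ⊥-elim (unique⇒lookup-≢ unique i<j
        (R-injective (Any.lookup-result (code′ i))
                     (subst (R _) (cong (List.lookup ys) (sym same)) (Any.lookup-result (code′ j)))))
  where
  code′ : ∀ i → Any (R (List.lookup xs i)) ys
  code′ i = code (∈-lookup i)

module Blocks (s : ℕ) .{{_ : NonZero s}} where

  block : Matrix → ℕ → ℕ → Matrix
  block M I J i j = M (I * s + i) (J * s + j)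

  contract : Matrix → Matrix
  contract M I J = 0 <ᵇ ones s (block M I J)

  ones-blocks : ∀ B M → ones (B * s) M ≡ ∑² B (λ I J → ones s (block M I J))
  ones-blocks B M = begin
    ones (B * s) M
      ≡⟨ ∑-upTo-* s B _ ⟩
    ∑[ I ← upTo B ] ∑[ i ← upTo s ] ∑[ y ← upTo (B * s) ] ⟦ M (I * s + i) y ⟧
      ≡⟨ ∑-cong (upTo B) (λ _ → ∑-cong (upTo s) (λ _ → ∑-upTo-* s B _)) ⟩
    ∑[ I ← upTo B ] ∑[ i ← upTo s ] ∑[ J ← upTo B ] ∑[ j ← upTo s ] ⟦ M (I * s + i) (J * s + j) ⟧
      ≡⟨ ∑-cong (upTo B) (λ {I} _ → ∑-comm (upTo s) (upTo B) _) ⟩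
    ∑² B (λ I J → ones s (block M I J))
      ∎
    where open ≡-Reasoning

  block-< : ∀ {I I′ i} → I < I′ → i < s → I * s + i < I′ * s
  block-< {I} {I′} {i} I<I′ i<s = begin-strict
    I * s + i  <⟨ +-monoʳ-< (I * s) i<s ⟩
    I * s + s  ≡⟨ +-comm (I * s) s ⟩
    suc I * s  ≤⟨ *-monoˡ-≤ s I<I′ ⟩
    I′ * s     ∎
    where open ≤-Reasoning

  block-<-block : ∀ {I I′ i i′} → I < I′ → i < s → I * s + i < I′ * s + i′
  block-<-block {I′ = I′} {i′ = i′} I<I′ i<s = <-≤-trans (block-< I<I′ i<s) (m≤m+n (I′ * s) i′)

  block-index : ∀ {B x} → x < B * s → ∃₂ λ I i → I < B × i < s × x ≡ I * s + i
  block-index {x = x} x<Bs =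
    x / s , x % s , m<n*o⇒m/o<n x<Bs , m%n<n x s , trans (m≡m%n+[m/n]*n x s) (+-comm (x % s) _)

  contract-occurrence : ∀ {k} {α β : Fin k → Fin k} {B M} →
                        Occurrence α β B (contract M) → Occurrence α β (B * s) M
  contract-occurrence {k} {M = M} o = record
    { row      = λ a → O.row a * s + i a
    ; col      = λ a → O.col a * s + j a
    ; row<N    = λ a → block-< (O.row<N a) (i<s a)
    ; col<N    = λ a → block-< (O.col<N a) (j<s a)
    ; row-mono = λ {a} lt → block-<-block (O.row-mono lt) (i<s a)
    ; col-mono = λ {a} lt → block-<-block (O.col-mono lt) (j<s a)
    ; hit      = hit
    }
    where
    module O = Occurrence o
    entry : ∀ a → ∃₂ λ i j → i < s × j < s × T (block M (O.row a) (O.col a) i j)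
    entry a = ones>0⇒hit s (block M (O.row a) (O.col a)) (<ᵇ⇒< 0 _ (O.hit a))
    i j : Fin k → ℕ
    i a = proj₁ (entry a)
    j a = proj₁ (proj₂ (entry a))
    i<s : ∀ a → i a < s
    i<s a = proj₁ (proj₂ (proj₂ (entry a)))
    j<s : ∀ a → j a < s
    j<s a = proj₁ (proj₂ (proj₂ (proj₂ (entry a))))
    hit : ∀ a → T (M (O.row a * s + i a) (O.col a * s + j a))
    hit a = proj₂ (proj₂ (proj₂ (proj₂ (entry a))))

  blockCells : ℕ → ℕ → List (ℕ × ℕ)
  blockCells I J = concatMap (λ i → map (λ j → (I * s + i , J * s + j)) (upTo s)) (upTo s)

  markedCells : ℕ → Matrix → List (ℕ × ℕ)
  markedCells B M′ =
    concatMap (λ I → concatMap (λ J → if M′ I J then blockCells I J else []) (upTo B)) (upTo B)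

  length-blockCells : ∀ I J → length (blockCells I J) ≡ s * s
  length-blockCells I J = begin
    length (blockCells I J)                                    ≡⟨ length-concatMap _ (upTo s) ⟩
    ∑[ i ← upTo s ] length (map (λ j → (I * s + i , J * s + j)) (upTo s))
      ≡⟨ ∑-cong (upTo s) (λ _ → trans (length-map _ (upTo s)) (length-upTo s)) ⟩
    ∑[ _ ← upTo s ] s                                          ≡⟨ ∑-const (upTo s) s ⟩
    length (upTo s) * s                                        ≡⟨ cong (_* s) (length-upTo s) ⟩
    s * s                                                      ∎
    where open ≡-Reasoning

  length-markedCells : ∀ B M′ → length (markedCells B M′) ≡ s * s * ones B M′
  length-markedCells B M′ = begin
    length (markedCells B M′)
      ≡⟨ length-concatMap _ (upTo B) ⟩
    ∑[ I ← upTo B ] length (concatMap (λ J → if M′ I J then blockCells I J else []) (upTo B))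
      ≡⟨ ∑-cong (upTo B) (λ {I} _ → length-concatMap _ (upTo B)) ⟩
    ∑² B (λ I J → length (if M′ I J then blockCells I J else []))
      ≡⟨ ∑²-cong B (λ {I} {J} _ _ → length-marked I J) ⟩
    ∑² B (λ I J → s * s * ⟦ M′ I J ⟧)
      ≡⟨ ∑²-*ˡ B (s * s) _ ⟩
    s * s * ones B M′
      ∎
    where
    open ≡-Reasoning
    length-marked : ∀ I J → length (if M′ I J then blockCells I J else []) ≡ s * s * ⟦ M′ I J ⟧
    length-marked I J with M′ I J
    ... | true  = trans (length-blockCells I J) (sym (*-identityʳ (s * s)))
    ... | false = sym (*-zeroʳ (s * s))

  ∈-markedCells : ∀ {B M′ I J i j} → T (M′ I J) → I < B → J < B → i < s → j < s →
                  (I * s + i , J * s + j) ∈ markedCells B M′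
  ∈-markedCells {M′ = M′} {I} {J} {i} {j} marked I<B J<B i<s j<s =
    ∈-concatMap⁺ (∈-upTo⁺ I<B) (∈-concatMap⁺ (∈-upTo⁺ J<B) (∈-if marked
      (∈-concatMap⁺ (∈-upTo⁺ i<s) (∈-map⁺ (λ j → (I * s + i , J * s + j)) (∈-upTo⁺ j<s)))))

  hit⇒∈markedCells : ∀ {B M M′ x y} → Agree B M′ (contract M) →
                     x < B * s → y < B * s → T (M x y) → (x , y) ∈ markedCells B M′
  hit⇒∈markedCells {B} {M} {M′} agree x<Bs y<Bs hit with block-index {B} x<Bs | block-index {B} y<Bs
  ... | I , i , I<B , i<s , refl | J , j , J<B , j<s , refl = ∈-markedCells {B} {M′} marked I<B J<B i<s j<s
    where
    marked : T (M′ I J)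
    marked = subst T (sym (agree I<B J<B)) (<⇒<ᵇ (hit⇒ones>0 (block M I J) i<s j<s hit))

module MarcusTardos (k : ℕ) where

  -- s > (k - 1)² makes the recurrence contract; s ≥ 2 makes the block sizes grow.
  s : ℕ
  s = 2 + k * k

  open Blocks s public

  wide : Matrix → ℕ → ℕ → Bool
  wide M I J = k ≤ᵇ width s (block M I J)

  tuples : List (Vector ℕ k)
  tuples = increasingTuples k s

  nonzeroColumnsAt : Matrix → ℕ → ℕ → Vector ℕ k → Bool
  nonzeroColumnsAt M I J g = ⌊ Fin.all? (λ a → T? (columnNonzero s (block M I J) (g a))) ⌋

  wide⇒nonzeroColumnsAt : ∀ M I J → ⟦ wide M I J ⟧ ≤ ∑[ g ← tuples ] ⟦ nonzeroColumnsAt M I J g ⟧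
  wide⇒nonzeroColumnsAt M I J with wide M I J in isWide
  ... | false = z≤n
  ... | true  =
    let g , g∈ , nonzero = ∃-increasingTuple k s (columnNonzero s (block M I J))
                                             (≤ᵇ⇒≤ k _ (subst T (sym isWide) tt))
    in  ≤-trans (≤-reflexive (sym (T⇒⟦⟧≡1 (fromWitness nonzero)))) (∈⇒≤∑ _ g∈)

  -- k blocks of block column J with nonzero columns at the positions g, taken as the rows
  -- ordered by α, contain an occurrence with its columns at g in the order β.
  few-nonzeroColumnsAt : ∀ {α β : Fin k → Fin k} {B M J} → ¬ Occurrence α β (B * s) M → J < B →
                         ∀ {g} → g ∈ tuples → ∑[ I ← upTo B ] ⟦ nonzeroColumnsAt M I J g ⟧ ≤ pred k
  few-nonzeroColumnsAt {α} {β} {B} {M} {J} avoids J<B {g} g∈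
    with k ≤? (∑[ I ← upTo B ] ⟦ nonzeroColumnsAt M I J g ⟧)
  ... | no  k≰count = <⇒≤pred (≰⇒> k≰count)
  ... | yes k≤count with ∃-increasingTuple k B (λ I → nonzeroColumnsAt M I J g) k≤count
  ...   | G , G∈ , covered = ⊥-elim (avoids occurrence)
    where
    G-inc : Increasing G
    G-inc = proj₁ (All.lookup (increasingTuples-increasing k B) G∈)
    G<B : ∀ a → G a < B
    G<B = proj₂ (All.lookup (increasingTuples-increasing k B) G∈)
    g-inc : Increasing g
    g-inc = proj₁ (All.lookup (increasingTuples-increasing k s) g∈)
    g<s : ∀ a → g a < s
    g<s = proj₂ (All.lookup (increasingTuples-increasing k s) g∈)
    entry : ∀ a → ∃[ i ] i ∈ upTo s × T (M (G (α a) * s + i) (J * s + g (β a)))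
    entry a = ∑>0⇒∃-T (upTo s) _ (<ᵇ⇒< 0 _ (toWitness (covered (α a)) (β a)))
    i : Fin k → ℕ
    i a = proj₁ (entry a)
    i<s : ∀ a → i a < s
    i<s a = ∈-upTo⁻ (proj₁ (proj₂ (entry a)))
    occurrence : Occurrence α β (B * s) M
    occurrence = record
      { row      = λ a → G (α a) * s + i a
      ; col      = λ a → J * s + g (β a)
      ; row<N    = λ a → block-< (G<B (α a)) (i<s a)
      ; col<N    = λ a → block-< J<B (g<s (β a))
      ; row-mono = λ {a} lt → block-<-block (G-inc lt) (i<s a)
      ; col-mono = λ lt → +-monoʳ-< (J * s) (g-inc lt)
      ; hit      = λ a → proj₂ (proj₂ (entry a))
      }

  X : ℕ
  X = length tuples * pred k

  wide-in-column : ∀ {α β : Fin k → Fin k} {B M J} → ¬ Occurrence α β (B * s) M → J < B →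
                   ∑[ I ← upTo B ] ⟦ wide M I J ⟧ ≤ X
  wide-in-column {B = B} {M} {J} avoids J<B = begin
    ∑[ I ← upTo B ] ⟦ wide M I J ⟧
      ≤⟨ ∑-mono (upTo B) (λ {I} _ → wide⇒nonzeroColumnsAt M I J) ⟩
    ∑[ I ← upTo B ] ∑[ g ← tuples ] ⟦ nonzeroColumnsAt M I J g ⟧
      ≡⟨ ∑-comm (upTo B) tuples _ ⟩
    ∑[ g ← tuples ] ∑[ I ← upTo B ] ⟦ nonzeroColumnsAt M I J g ⟧
      ≤⟨ ∑-≤-const tuples (few-nonzeroColumnsAt avoids J<B) ⟩
    X
      ∎
    where open ≤-Reasoning

  wide-blocks : ∀ {α β : Fin k → Fin k} {B M} → ¬ Occurrence α β (B * s) M →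
                ∑² B (λ I J → ⟦ wide M I J ⟧) ≤ B * X
  wide-blocks {B = B} {M} avoids = begin
    ∑² B (λ I J → ⟦ wide M I J ⟧)  ≡⟨ ∑²-comm B _ ⟩
    ∑² B (λ J I → ⟦ wide M I J ⟧)  ≤⟨ ∑-≤-const (upTo B) (λ J∈ → wide-in-column avoids (∈-upTo⁻ J∈)) ⟩
    length (upTo B) * X            ≡⟨ cong (_* X) (length-upTo B) ⟩
    B * X                          ∎
    where open ≤-Reasoning

  K : ℕ
  K = pred k * pred k

  ones-step : ∀ {α β : Fin k → Fin k} {B M} → ¬ Occurrence α β (B * s) M →
              ones (B * s) M ≤ K * ones B (contract M) + s * s * (B * X) + s * s * (B * X)
  ones-step {B = B} {M} avoids = begin
    ones (B * s) M
      ≡⟨ ones-blocks B M ⟩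
    ∑² B (λ I J → ones s (block M I J))
      ≤⟨ ∑²-mono B (λ {I} {J} _ _ → ones≤narrow+wide+tall k s (block M I J)) ⟩
    ∑² B (λ I J → contracted I J + wideTerm I J + tallTerm I J)
      ≡⟨ trans (∑²-+ B (λ I J → contracted I J + wideTerm I J) tallTerm)
               (cong (_+ ∑² B tallTerm) (∑²-+ B contracted wideTerm)) ⟩
    ∑² B contracted + ∑² B wideTerm + ∑² B tallTerm
      ≤⟨ +-mono-≤ (+-mono-≤ (≤-reflexive (∑²-*ˡ B K _)) (scaled wide-M)) (scaled wide-Mᵀ) ⟩
    K * ones B (contract M) + s * s * (B * X) + s * s * (B * X)
      ∎
    where
    open ≤-Reasoning
    contracted wideTerm tallTerm : ℕ → ℕ → ℕ
    contracted I J = K * ⟦ contract M I J ⟧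
    wideTerm   I J = s * s * ⟦ wide M I J ⟧
    tallTerm   I J = s * s * ⟦ wide (transpose M) J I ⟧
    scaled : ∀ {f} → ∑² B f ≤ B * X → ∑² B (λ I J → s * s * f I J) ≤ s * s * (B * X)
    scaled ∑f≤ = ≤-trans (≤-reflexive (∑²-*ˡ B (s * s) _)) (*-monoʳ-≤ (s * s) ∑f≤)
    wide-M : ∑² B (λ I J → ⟦ wide M I J ⟧) ≤ B * X
    wide-M = wide-blocks {B = B} {M} avoids
    wide-Mᵀ : ∑² B (λ I J → ⟦ wide (transpose M) J I ⟧) ≤ B * X
    wide-Mᵀ = ≤-trans (≤-reflexive (∑²-comm B (λ I J → ⟦ wide (transpose M) J I ⟧)))
                      (wide-blocks {B = B} {transpose M} (avoids ∘ occurrence-transpose))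

  -- As K + 1 ≤ s, B ↦ c B is a supersolution of the recurrence of ones-step.
  c : ℕ
  c = suc (s * s * X + s * s * X)

  ones-linear : ∀ {α β : Fin k → Fin k} j {M} → ¬ Occurrence α β (s ^ j) M →
                ones (s ^ j) M ≤ c * s ^ j
  ones-linear zero    {M} _      = ≤-trans (ones≤N*N 1 M) (s≤s z≤n)
  ones-linear {α} {β} (suc j) {M} avoids =
    subst (λ N → ones N M ≤ c * N) (*-comm B s) (begin
      ones (B * s) M
        ≤⟨ ones-step {B = B} {M} avoids′ ⟩
      K * ones B (contract M) + s * s * (B * X) + s * s * (B * X)
        ≤⟨ +-monoˡ-≤ _ (+-monoˡ-≤ _ (*-monoʳ-≤ K ih)) ⟩
      K * (c * B) + s * s * (B * X) + s * s * (B * X)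
        ≡⟨ regroup (K * (c * B)) (s * s) B X ⟩
      K * (c * B) + (s * s * X + s * s * X) * B
        ≤⟨ +-monoʳ-≤ (K * (c * B)) (*-monoˡ-≤ B (n≤1+n (s * s * X + s * s * X))) ⟩
      K * (c * B) + c * B
        ≡⟨ +-comm (K * (c * B)) (c * B) ⟩
      suc K * (c * B)
        ≤⟨ *-monoˡ-≤ (c * B) K<s ⟩
      s * (c * B)
        ≡⟨ rotate s c B ⟩
      c * (B * s)
        ∎)
    where
    open ≤-Reasoning
    B = s ^ j
    avoids′ : ¬ Occurrence α β (B * s) M
    avoids′ = avoids ∘ subst (λ N → Occurrence α β N M) (*-comm B s)
    ih : ones B (contract M) ≤ c * B
    ih = ones-linear j (avoids′ ∘ contract-occurrence {M = M})
    K<s : suc K ≤ s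
    K<s = s≤s (≤-trans (*-mono-≤ (pred[n]≤n {k}) (pred[n]≤n {k})) (n≤1+n _))
    regroup : ∀ a t B′ X′ → a + t * (B′ * X′) + t * (B′ * X′) ≡ a + (t * X′ + t * X′) * B′
    regroup = solve-∀
    rotate : ∀ s′ c′ B′ → s′ * (c′ * B′) ≡ c′ * (B′ * s′)
    rotate = solve-∀

∃-power-between : ∀ {s N} → 2 ≤ s → 1 ≤ N → ∃[ j ] N ≤ s ^ j × s ^ j ≤ s * N
∃-power-between {s} {suc N} 2≤s _ = go N
  where
  go : ∀ N → ∃[ j ] suc N ≤ s ^ j × s ^ j ≤ s * suc N
  go zero = 0 , ≤-refl , ≤-trans (≤-trans (n≤1+n 1) 2≤s) (≤-reflexive (sym (*-identityʳ s)))
  go (suc N) with go N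
  ... | j , N<s^j , s^j≤sN with suc (suc N) ≤? s ^ j
  ...   | yes N+1<s^j = j , N+1<s^j , ≤-trans s^j≤sN (*-monoʳ-≤ s (n≤1+n _))
  ...   | no  N+1≮s^j = suc j , N+1<s^j+1 , *-monoʳ-≤ s (≤-trans (≤-reflexive s^j≡N+1) (n≤1+n _))
    where
    s^j≡N+1 : s ^ j ≡ suc N
    s^j≡N+1 = ≤-antisym (s≤s⁻¹ (≰⇒> N+1≮s^j)) N<s^j
    N+1<s^j+1 : suc (suc N) ≤ s * s ^ j
    N+1<s^j+1 = begin
      suc (suc N)      ≤⟨ s≤s (m≤n+m (suc N) N) ⟩
      suc N + suc N    ≡⟨ cong (suc N +_) (+-identityʳ (suc N)) ⟨
      2 * suc N        ≤⟨ *-monoˡ-≤ (suc N) 2≤s ⟩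
      s * suc N        ≡⟨ cong (s *_) s^j≡N+1 ⟨
      s * s ^ j        ∎
      where open ≤-Reasoning

module Klazar (k : ℕ) where

  open MarcusTardos k public

  refinements : ℕ → Matrix → List Matrix
  refinements j M′ =
    if ones (s ^ j) M′ ≤ᵇ c * s ^ j then subMatrices (markedCells (s ^ j) M′) else []

  candidates : ℕ → List Matrix
  candidates zero    = (λ _ _ → false) ∷ (λ _ _ → true) ∷ []
  candidates (suc j) = concatMap (refinements j) (candidates j)

  refinements-cover : ∀ {α β : Fin k → Fin k} j {M M′} → ¬ Occurrence α β (s ^ suc j) M →
                      Agree (s ^ j) M′ (contract M) → ∃[ M₀ ] M₀ ∈ refinements j M′ × Agree (s ^ suc j) M₀ M
  refinements-cover {α} {β} j {M} {M′} avoids agree with ∃-subMatrix (markedCells (s ^ j) M′) M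
  ... | M₀ , M₀∈ , M₀⊆M , M₀≡M = M₀ , ∈-if sparse M₀∈ , agree₀
    where
    B = s ^ j
    contract-avoids : ¬ Occurrence α β B (contract M)
    contract-avoids = avoids ∘ subst (λ N → Occurrence α β N M) (*-comm B s) ∘ contract-occurrence {M = M}
    sparse : T (ones B M′ ≤ᵇ c * B)
    sparse = ≤⇒≤ᵇ (subst (_≤ c * B) (sym (agree-ones agree)) (ones-linear j contract-avoids))
    agree₀ : Agree (s * B) M₀ M
    agree₀ {x} {y} x<sB y<sB with M x y in Mxy
    ... | false = ⊆-false {M₀} {M} M₀⊆M Mxy
    ... | true  = trans (M₀≡M (hit⇒∈markedCells {B} {M} {M′} agree x<Bs y<Bs (subst T (sym Mxy) tt))) Mxy
      where
      x<Bs : x < B * s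
      x<Bs = subst (x <_) (*-comm s B) x<sB
      y<Bs : y < B * s
      y<Bs = subst (y <_) (*-comm s B) y<sB

  candidates-cover : ∀ {α β : Fin k → Fin k} j {M} → ¬ Occurrence α β (s ^ j) M →
                     ∃[ M₀ ] M₀ ∈ candidates j × Agree (s ^ j) M₀ M
  candidates-cover zero {M} _ with M 0 0 in M00
  ... | false = _ , here refl ,         λ { (s≤s z≤n) (s≤s z≤n) → sym M00 }
  ... | true  = _ , there (here refl) , λ { (s≤s z≤n) (s≤s z≤n) → sym M00 }
  candidates-cover {α} {β} (suc j) {M} avoids =
    let M′ , M′∈ , agree′ = candidates-cover j (avoids ∘ lift)
        M₀ , M₀∈ , agree₀ = refinements-cover j avoids agree′
    in  M₀ , ∈-concatMap⁺ M′∈ M₀∈ , agree₀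
    where
    lift : Occurrence α β (s ^ j) (contract M) → Occurrence α β (s ^ suc j) M
    lift = subst (λ N → Occurrence α β N M) (*-comm (s ^ j) s) ∘ contract-occurrence {M = M}

  D : ℕ
  D = s * s * c

  length-refinements : ∀ j M′ → length (refinements j M′) ≤ 2 ^ (D * s ^ j)
  length-refinements j M′ with ones (s ^ j) M′ ≤ᵇ c * s ^ j in sparse
  ... | false = z≤n
  ... | true  = begin
    length (subMatrices (markedCells (s ^ j) M′))  ≡⟨ length-subMatrices (markedCells (s ^ j) M′) ⟩
    2 ^ length (markedCells (s ^ j) M′)            ≡⟨ cong (2 ^_) (length-markedCells (s ^ j) M′) ⟩
    2 ^ (s * s * ones (s ^ j) M′)                  ≤⟨ ^-monoʳ-≤ 2 (*-monoʳ-≤ (s * s) ones≤) ⟩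
    2 ^ (s * s * (c * s ^ j))                      ≡⟨ cong (2 ^_) (*-assoc (s * s) c (s ^ j)) ⟨
    2 ^ (D * s ^ j)                                ∎
    where
    open ≤-Reasoning
    ones≤ : ones (s ^ j) M′ ≤ c * s ^ j
    ones≤ = ≤ᵇ⇒≤ (ones (s ^ j) M′) (c * s ^ j) (subst T (sym sparse) tt)

  powerSum : ℕ → ℕ
  powerSum zero    = 0
  powerSum (suc j) = powerSum j + s ^ j

  powerSum≤ : ∀ j → powerSum j ≤ s ^ j
  powerSum≤ zero    = z≤n
  powerSum≤ (suc j) = ≤-trans (+-monoˡ-≤ (s ^ j) (powerSum≤ j)) (+-monoʳ-≤ (s ^ j) (m≤m+n (s ^ j) _))

  length-candidates : ∀ j → length (candidates j) ≤ 2 ^ (1 + D * powerSum j)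
  length-candidates zero    = ≤-reflexive (cong (λ e → 2 ^ (1 + e)) (sym (*-zeroʳ D)))
  length-candidates (suc j) = begin
    length (concatMap (refinements j) (candidates j))
      ≡⟨ length-concatMap (refinements j) (candidates j) ⟩
    ∑[ M′ ← candidates j ] length (refinements j M′)
      ≤⟨ ∑-≤-const (candidates j) (λ _ → length-refinements j _) ⟩
    length (candidates j) * 2 ^ (D * s ^ j)
      ≤⟨ *-monoˡ-≤ _ (length-candidates j) ⟩
    2 ^ (1 + D * powerSum j) * 2 ^ (D * s ^ j)
      ≡⟨ ^-distribˡ-+-* 2 (1 + D * powerSum j) _ ⟨
    2 ^ (1 + D * powerSum j + D * s ^ j)
      ≡⟨ cong (λ e → 2 ^ suc e) (*-distribˡ-+ D (powerSum j) (s ^ j)) ⟨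
    2 ^ (1 + D * powerSum (suc j))
      ∎
    where open ≤-Reasoning

  length-candidates≤ : ∀ {j N} → 1 ≤ N → s ^ j ≤ s * N →
                       length (candidates j) ≤ (2 ^ (1 + D * s)) ^ N
  length-candidates≤ {j} {N} 1≤N s^j≤sN = begin
    length (candidates j)       ≤⟨ length-candidates j ⟩
    2 ^ (1 + D * powerSum j)    ≤⟨ ^-monoʳ-≤ 2 (+-mono-≤ 1≤N (*-monoʳ-≤ D (≤-trans (powerSum≤ j) s^j≤sN))) ⟩
    2 ^ (N + D * (s * N))       ≡⟨ cong (λ e → 2 ^ (N + e)) (*-assoc D s N) ⟨
    2 ^ ((1 + D * s) * N)       ≡⟨ ^-*-assoc 2 (1 + D * s) N ⟨
    (2 ^ (1 + D * s)) ^ N       ∎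
    where open ≤-Reasoning

  length-avoiders : ∀ {q n L j} → IsPermutation k q → n ≤ s ^ j → L ≤ s ^ j →
                    (ps : List (Vec (Fin n) L)) → Unique ps → All (λ p → Avoids p q) ps →
                    length ps ≤ length (candidates j)
  length-avoiders {q} {n} {L} {j} q-perm n≤ L≤ ps unique avoid =
    length-≤-by-code (λ p M₀ → Agree (s ^ j) M₀ (wordMatrix p)) unique code injective
    where
    code : ∀ {p} → p ∈ ps → Any (λ M₀ → Agree (s ^ j) M₀ (wordMatrix p)) (candidates j)
    code {p} p∈ =
      let M₀ , M₀∈ , agree = candidates-cover j (All.lookup avoid p∈ ∘ occurrence⇒contains q-perm p)
      in  lose M₀∈ agree
    injective : ∀ {p p′ M₀} → Agree (s ^ j) M₀ (wordMatrix p) → Agree (s ^ j) M₀ (wordMatrix p′) →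
                p ≡ p′
    injective agree agree′ = wordMatrix-injective _ _ λ x<n y<L →
      let x<N = <-≤-trans x<n n≤; y<N = <-≤-trans y<L L≤
      in  trans (sym (agree x<N y<N)) (agree′ x<N y<N)

theorem2 : (k : ℕ) → k ≥ 1 →
    Σ ℕ λ e →
    ∀ (q : Fin k → Fin k) → IsPermutation k q →
    ∀ (n m : ℕ) → n ≥ 1 → m ≥ 1 →
    ∀ (ps : List (Vec (Fin n) (n * m))) →
    Unique ps →
    All (λ p → IsMultisetPerm n m p × Avoids p q) ps →
    length ps ≤ e ^ (n * m)
theorem2 k _ = 2 ^ (1 + D * s) , λ q q-perm n m n≥1 m≥1 ps unique perms →
  let nm≥1                  = *-mono-≤ n≥1 m≥1
      j , nm≤s^j , s^j≤s·nm = ∃-power-between (s≤s (s≤s z≤n)) nm≥1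
      n≤s^j                 = ≤-trans (m≤m*n n m {{>-nonZero m≥1}}) nm≤s^j
  in  ≤-trans (length-avoiders {j = j} q-perm n≤s^j nm≤s^j ps unique (All.map proj₂ perms))
              (length-candidates≤ {j} nm≥1 s^j≤s·nm)
  where open Klazar k
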